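{- Let $F\subseteq E(Q_4)$ with $|F|=1$ and let $M$ be a matching of $Q_4-F$ with $|M|=4$ such that $|M\cap E_i|=1$ for every $i\in[4]$. Then there exists a Hamiltonian cycle of $Q_4-F$ containing $M$.
   Context: $Q_4$ is the 4-dimensional hypercube; $E_i$ is the set of edges whose endpoints differ in coordinate $i$; $Q_4-F$ is $Q_4$ with the edges of $F$ deleted. A matching is a set of pairwise vertex-disjoint edges. -}

module Defs where

open import Data.Bool using (Bool; not)
open import Data.Fin using (Fin; toℕ; fromℕ<)
open import Data.Nat using (ℕ; suc)
open import Data.Nat.DivMod using (_%_; m%n<n)
open import Data.Vec using (Vec; lookup; _[_]%=_)
open import Data.Product using (Σ; ∃-syntax; _×_; _,_; proj₁; proj₂)
open import Data.Sum using (_⊎_)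
open import Relation.Binary.PropositionalEquality using (_≡_; _≢_)
open import Relation.Nullary using (¬_)
open import Function.Definitions using (Injective)

Vertex : Set
Vertex = Vec Bool 4

Adj : Vertex → Vertex → Set
Adj u v = ∃[ i ] (v ≡ u [ i ]%= not)

-- An edge is represented by an (ordered) pair of its endpoints;
-- edges are compared as unordered pairs via SameEdge.
Edge : Set
Edge = Vertex × Vertex

IsEdge : Edge → Set
IsEdge (u , v) = Adj u v

SameEdge : Edge → Edge → Set
SameEdge (a , b) (c , d) = (a ≡ c × b ≡ d) ⊎ (a ≡ d × b ≡ c)

InDir : Fin 4 → Edge → Set
InDir i (u , v) = lookup u i ≢ lookup v i

EdgeOfQ4-f : Edge → Edge → Set
EdgeOfQ4-f f e = IsEdge e × ¬ SameEdge e f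

Disjoint : Edge → Edge → Set
Disjoint (a , b) (c , d) = a ≢ c × a ≢ d × b ≢ c × b ≢ d

next : Fin 16 → Fin 16
next k = fromℕ< (m%n<n (suc (toℕ k)) 16)

-- A Hamiltonian cycle of Q_4 - {f}: a cyclic ordering c 0, …, c 15 of
-- distinct vertices (hence all 16 vertices) with consecutive vertices
-- (including c 15, c 0) adjacent in Q_4 - {f}.
IsHamCycle : Edge → (Fin 16 → Vertex) → Set
IsHamCycle f c = Injective _≡_ _≡_ c × (∀ k → EdgeOfQ4-f f (c k , c (next k)))

CycleContains : (Fin 16 → Vertex) → Edge → Set
CycleContains c e = ∃[ k ] SameEdge e (c k , c (next k))

-- The translations v ↦ a ⊕ v are automorphisms of Q₄ preserving edge directions, so we
-- may assume that the edge of M in direction 0 is {0000, 1000}. Each other edge of M is then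
-- determined by its endpoint bᵢ with i-th coordinate 0, leaving 76 configurations
-- (b₁, b₂, b₃). For each of them a table lists at most three Hamiltonian cycles of Q₄
-- through M whose only common edges are those of M, so whichever edge F removes, one of
-- these cycles survives. The table is checked by evaluation.
module Submission where

open import Defs
open import Data.Bool using (Bool; true; false; not; _xor_; if_then_else_)
open import Data.Bool.Properties using (not-involutive; not-¬; xor-assoc; xor-same; not-distribʳ-xor)
  renaming (_≟_ to _≟ᵇ_)
open import Data.Empty using (⊥; ⊥-elim)
open import Data.Fin using (Fin; zero; suc) renaming (_≟_ to _≟ᶠ_)
open import Data.Fin.Properties using (all?; any?)
open import Data.List using (List; []; _∷_; map)
import Data.List.Relation.Unary.All as All
open All using (All; lookupAny)
import Data.List.Relation.Unary.Any as Any
open Any using (Any)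
open import Data.Nat using (ℕ; zero; suc; _+_; _*_; _≡ᵇ_)
open import Data.Nat.DivMod using (_%_; _/_)
open import Data.Product using (∃-syntax; _×_; _,_; proj₁; proj₂)
open import Data.Sum using (_⊎_; inj₁; inj₂)
open import Data.Vec using (Vec; []; _∷_; lookup; _[_]%=_; zipWith; replicate)
open import Data.Vec.Properties using (≡-dec; lookup∘updateAt; lookup∘updateAt′)
open import Function using (_∘_)
open import Function.Definitions using (Injective)
open import Relation.Binary.Definitions using (DecidableEquality)
open import Relation.Binary.PropositionalEquality
  using (_≡_; _≢_; refl; sym; trans; cong; cong₂; subst; subst₂)
open import Relation.Nullary using (¬_; Dec; yes; no)
open import Relation.Nullary.Decidable using (map′; toWitness; _×-dec_; _⊎-dec_; _→-dec_; ¬?)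

private variable
  m n : ℕ
  I J : Set

allVec? : {P : Vec Bool n → Set} → (∀ v → Dec (P v)) → Dec (∀ v → P v)
allVec? {zero}  P? = map′ (λ p → λ { [] → p }) (λ h → h []) (P? [])
allVec? {suc n} P? =
  map′ (λ (t , f) → λ { (true ∷ v) → t v ; (false ∷ v) → f v })
       (λ h → (λ v → h (true ∷ v)) , (λ v → h (false ∷ v)))
       (allVec? (P? ∘ (true ∷_)) ×-dec allVec? (P? ∘ (false ∷_)))

injective? : {A : Set} → DecidableEquality A → (c : Fin n → A) → Dec (Injective _≡_ _≡_ c)
injective? _≟_ c =
  map′ (λ h {k} {l} → h k l) (λ h k l → h)
       (all? λ k → all? λ l → (c k ≟ c l) →-dec (k ≟ᶠ l))

flip : Fin n → Vec Bool n → Vec Bool n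
flip i u = u [ i ]%= not

flip-involutive : ∀ (i : Fin n) u → flip i (flip i u) ≡ u
flip-involutive zero    (x ∷ u) = cong (_∷ u) (not-involutive x)
flip-involutive (suc i) (x ∷ u) = cong (x ∷_) (flip-involutive i u)

flip-changes : ∀ (i : Fin n) u → lookup u i ≢ lookup (flip i u) i
flip-changes i u eq = not-¬ refl (trans eq (lookup∘updateAt i u))

flip-changes-only : ∀ (d i : Fin n) u → lookup u i ≢ lookup (flip d u) i → d ≡ i
flip-changes-only d i u changed with d ≟ᶠ i
... | yes d≡i = d≡i
... | no  d≢i = ⊥-elim (changed (sym (lookup∘updateAt′ i d (d≢i ∘ sym) u)))

lowEnd : Fin n → Vec Bool n → Vec Bool n
lowEnd i u = if lookup u i then flip i u else u

lowEnd-lookup : ∀ (i : Fin n) u → lookup (lowEnd i u) i ≡ false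
lowEnd-lookup i u with lookup u i in eq
... | true  = trans (lookup∘updateAt i u) (cong not eq)
... | false = eq

infixr 6 _⊕_
_⊕_ : Vec Bool n → Vec Bool n → Vec Bool n
_⊕_ = zipWith _xor_

⊕-cancelˡ : ∀ (a v : Vec Bool n) → a ⊕ (a ⊕ v) ≡ v
⊕-cancelˡ []      []      = refl
⊕-cancelˡ (x ∷ a) (y ∷ v) =
  cong₂ _∷_ (trans (sym (xor-assoc x x y)) (cong (_xor y) (xor-same x))) (⊕-cancelˡ a v)

⊕-self : ∀ (a : Vec Bool n) → a ⊕ a ≡ replicate n false
⊕-self []      = refl
⊕-self (x ∷ a) = cong₂ _∷_ (xor-same x) (⊕-self a)

⊕-flip : ∀ (a : Vec Bool n) i v → a ⊕ flip i v ≡ flip i (a ⊕ v)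
⊕-flip (x ∷ a) zero    (y ∷ v) = cong (_∷ (a ⊕ v)) (sym (not-distribʳ-xor x y))
⊕-flip (x ∷ a) (suc i) (y ∷ v) = cong ((x xor y) ∷_) (⊕-flip a i v)

⊕-swap : ∀ (a : Vec Bool n) {u v} → a ⊕ u ≡ v → u ≡ a ⊕ v
⊕-swap a {u} refl = sym (⊕-cancelˡ a u)

⊕-injective : ∀ (a : Vec Bool n) {u v} → a ⊕ u ≡ a ⊕ v → u ≡ v
⊕-injective a {v = v} eq = trans (⊕-swap a eq) (⊕-cancelˡ a v)

_≟ᵛ_ : DecidableEquality Vertex
_≟ᵛ_ = ≡-dec _≟ᵇ_

edgeAt : Fin 4 → Vertex → Edge
edgeAt i u = (u , flip i u)

isEdge? : ∀ e → Dec (IsEdge e)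
isEdge? (u , v) = any? λ i → v ≟ᵛ flip i u

sameEdge? : ∀ x y → Dec (SameEdge x y)
sameEdge? (a , b) (c , d) = ((a ≟ᵛ c) ×-dec (b ≟ᵛ d)) ⊎-dec ((a ≟ᵛ d) ×-dec (b ≟ᵛ c))

disjoint? : ∀ x y → Dec (Disjoint x y)
disjoint? (a , b) (c , d) = ¬? (a ≟ᵛ c) ×-dec ¬? (a ≟ᵛ d) ×-dec ¬? (b ≟ᵛ c) ×-dec ¬? (b ≟ᵛ d)

SameEdge-reflexive : ∀ {x y} → x ≡ y → SameEdge x y
SameEdge-reflexive refl = inj₁ (refl , refl)

SameEdge-sym : ∀ {x y} → SameEdge x y → SameEdge y x
SameEdge-sym (inj₁ (refl , refl)) = inj₁ (refl , refl)
SameEdge-sym (inj₂ (refl , refl)) = inj₂ (refl , refl)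

SameEdge-trans : ∀ {x y z} → SameEdge x y → SameEdge y z → SameEdge x z
SameEdge-trans (inj₁ (refl , refl)) s                    = s
SameEdge-trans (inj₂ (refl , refl)) (inj₁ (refl , refl)) = inj₂ (refl , refl)
SameEdge-trans (inj₂ (refl , refl)) (inj₂ (refl , refl)) = inj₁ (refl , refl)

Disjoint-respˡ : ∀ {x x' y} → SameEdge x x' → Disjoint x y → Disjoint x' y
Disjoint-respˡ (inj₁ (refl , refl)) d               = d
Disjoint-respˡ (inj₂ (refl , refl)) (p , q , r , s) = r , s , p , q

Disjoint-respʳ : ∀ {x y y'} → SameEdge y y' → Disjoint x y → Disjoint x y'
Disjoint-respʳ (inj₁ (refl , refl)) d               = d
Disjoint-respʳ (inj₂ (refl , refl)) (p , q , r , s) = q , p , s , r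

Disjoint-resp : ∀ {x x' y y'} → SameEdge x x' → SameEdge y y' → Disjoint x y → Disjoint x' y'
Disjoint-resp x~x' y~y' = Disjoint-respʳ y~y' ∘ Disjoint-respˡ x~x'

edgeAt-lowEnd : ∀ i u → SameEdge (edgeAt i u) (edgeAt i (lowEnd i u))
edgeAt-lowEnd i u with lookup u i
... | true  = inj₂ (sym (flip-involutive i u) , refl)
... | false = inj₁ (refl , refl)

IsEdge⇒InDir : ∀ e → IsEdge e → ∃[ i ] InDir i e
IsEdge⇒InDir (u , _) (i , refl) = i , flip-changes i u

InDir-unique : ∀ e {i i'} → IsEdge e → InDir i e → InDir i' e → i ≡ i'
InDir-unique (u , _) {i} {i'} (d , refl) inDir inDir' =
  trans (sym (flip-changes-only d i u inDir)) (flip-changes-only d i' u inDir')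

InDir⇒edgeAt : ∀ e i → IsEdge e → InDir i e → SameEdge e (edgeAt i (lowEnd i (proj₁ e)))
InDir⇒edgeAt (u , _) i (d , refl) inDir with flip-changes-only d i u inDir
... | refl = edgeAt-lowEnd d u

infixr 6 _⊕ᴱ_
_⊕ᴱ_ : Vertex → Edge → Edge
a ⊕ᴱ (u , v) = (a ⊕ u , a ⊕ v)

⊕ᴱ-edgeAt : ∀ a i u → a ⊕ᴱ edgeAt i u ≡ edgeAt i (a ⊕ u)
⊕ᴱ-edgeAt a i u = cong (a ⊕ u ,_) (⊕-flip a i u)

IsEdge-⊕ : ∀ a e → IsEdge e → IsEdge (a ⊕ᴱ e)
IsEdge-⊕ a (u , _) (i , refl) = i , ⊕-flip a i u

SameEdge-⊕⁻ : ∀ a x y → SameEdge (a ⊕ᴱ x) (a ⊕ᴱ y) → SameEdge x y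
SameEdge-⊕⁻ a (_ , _) (_ , _) (inj₁ (p , q)) = inj₁ (⊕-injective a p , ⊕-injective a q)
SameEdge-⊕⁻ a (_ , _) (_ , _) (inj₂ (p , q)) = inj₂ (⊕-injective a p , ⊕-injective a q)

SameEdge-⊕-swap : ∀ a x y → SameEdge (a ⊕ᴱ x) y → SameEdge x (a ⊕ᴱ y)
SameEdge-⊕-swap a (_ , _) (_ , _) (inj₁ (p , q)) = inj₁ (⊕-swap a p , ⊕-swap a q)
SameEdge-⊕-swap a (_ , _) (_ , _) (inj₂ (p , q)) = inj₂ (⊕-swap a p , ⊕-swap a q)

Disjoint-⊕ : ∀ a x y → Disjoint x y → Disjoint (a ⊕ᴱ x) (a ⊕ᴱ y)
Disjoint-⊕ a (_ , _) (_ , _) (p , q , r , s) =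
  p ∘ ⊕-injective a , q ∘ ⊕-injective a , r ∘ ⊕-injective a , s ∘ ⊕-injective a

HamThrough : (I → Edge) → Set
HamThrough M = ∀ f → (∀ j → ¬ SameEdge (M j) f) →
  ∃[ c ] (IsHamCycle f c × (∀ j → CycleContains c (M j)))

_⊆ᴱ_ : (I → Edge) → (J → Edge) → Set
M ⊆ᴱ N = ∀ j → ∃[ i ] SameEdge (M j) (N i)

CycleContains-resp : ∀ {c e e'} → SameEdge e e' → CycleContains c e' → CycleContains c e
CycleContains-resp e~e' (k , e'~ck) = k , SameEdge-trans e~e' e'~ck

HamThrough-resp : {M : I → Edge} {N : J → Edge} → M ⊆ᴱ N → N ⊆ᴱ M → HamThrough M → HamThrough N
HamThrough-resp {M = M} {N} M⊆N N⊆M ham f f∉N with ham f f∉M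
  where
  f∉M : ∀ j → ¬ SameEdge (M j) f
  f∉M j Mj~f = let (i , Mj~Ni) = M⊆N j in f∉N i (SameEdge-trans (SameEdge-sym Mj~Ni) Mj~f)
... | c , ham-c , through =
  c , ham-c , λ i → let (j , Ni~Mj) = N⊆M i in CycleContains-resp Ni~Mj (through j)

IsHamCycle-⊕ : ∀ a f c → IsHamCycle (a ⊕ᴱ f) c → IsHamCycle f (λ k → a ⊕ c k)
IsHamCycle-⊕ a f c (injective , edges) =
  injective ∘ ⊕-injective a ,
  λ k → IsEdge-⊕ a _ (proj₁ (edges k)) , proj₂ (edges k) ∘ SameEdge-⊕-swap a _ f

HamThrough-translate : ∀ a (M : I → Edge) → HamThrough (λ j → a ⊕ᴱ M j) → HamThrough M
HamThrough-translate a M ham f f∉M with ham (a ⊕ᴱ f) (λ j → f∉M j ∘ SameEdge-⊕⁻ a (M j) f)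
... | c , ham-c , through =
  (λ k → a ⊕ c k) , IsHamCycle-⊕ a f c ham-c ,
  λ j → let (k , s) = through j in k , SameEdge-⊕-swap a (M j) _ s

edgeOf : (Fin 16 → Vertex) → Fin 16 → Edge
edgeOf c k = (c k , c (next k))

Avoids : (Fin 16 → Vertex) → Edge → Set
Avoids c f = ∀ k → ¬ SameEdge (edgeOf c k) f

IsCycleThrough : (Fin m → Edge) → (Fin 16 → Vertex) → Set
IsCycleThrough M c =
  Injective _≡_ _≡_ c × (∀ k → IsEdge (edgeOf c k)) × (∀ j → CycleContains c (M j))

-- Hamiltonian cycles through M whose common edges are exactly those of M; it suffices
-- that each edge of the first cycle outside M is avoided by a later one.
CyclesMeetIn : (Fin m → Edge) → List (Fin 16 → Vertex) → Set
CyclesMeetIn M []       = ⊥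
CyclesMeetIn M (c ∷ cs) = All (IsCycleThrough M) (c ∷ cs) ×
  (∀ k → (∃[ j ] SameEdge (M j) (edgeOf c k)) ⊎ Any (λ c' → Avoids c' (edgeOf c k)) cs)

avoids? : ∀ c f → Dec (Avoids c f)
avoids? c f = all? λ k → ¬? (sameEdge? (edgeOf c k) f)

isCycleThrough? : ∀ (M : Fin m → Edge) c → Dec (IsCycleThrough M c)
isCycleThrough? M c =
  injective? _≟ᵛ_ c ×-dec
  (all? λ k → isEdge? (edgeOf c k)) ×-dec
  (all? λ j → any? λ k → sameEdge? (M j) (edgeOf c k))

cyclesMeetIn? : ∀ (M : Fin m → Edge) cs → Dec (CyclesMeetIn M cs)
cyclesMeetIn? M []       = no λ ()
cyclesMeetIn? M (c ∷ cs) =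
  All.all? (isCycleThrough? M) (c ∷ cs) ×-dec
  (all? λ k → (any? λ j → sameEdge? (M j) (edgeOf c k)) ⊎-dec
              Any.any? (λ c' → avoids? c' (edgeOf c k)) cs)

IsCycleThrough⇒HamCycle : ∀ {M : Fin m → Edge} {c f} → IsCycleThrough M c → Avoids c f →
  IsHamCycle f c × (∀ j → CycleContains c (M j))
IsCycleThrough⇒HamCycle (injective , edges , through) avoids =
  (injective , λ k → edges k , avoids k) , through

CyclesMeetIn⇒HamThrough : ∀ (M : Fin m → Edge) cs → CyclesMeetIn M cs → HamThrough M
CyclesMeetIn⇒HamThrough M (c ∷ cs) (through , cover) f f∉M
  with any? (λ k → sameEdge? (edgeOf c k) f)
... | no f∉c = c , IsCycleThrough⇒HamCycle (All.head through) λ k ck~f → f∉c (k , ck~f)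
... | yes (k , ck~f) with cover k
...   | inj₁ (j , Mj~ck) = ⊥-elim (f∉M j (SameEdge-trans Mj~ck ck~f))
...   | inj₂ avoiders =
  let (through' , avoids) = lookupAny (All.tail through) avoiders
  in  _ , IsCycleThrough⇒HamCycle through'
              λ l c'l~f → avoids l (SameEdge-trans c'l~f (SameEdge-sym ck~f))

canonical : (Fin 4 → Vertex) → Fin 4 → Edge
canonical b i = edgeAt i (b i)

IsNormal : (Fin 4 → Vertex) → Set
IsNormal b = (∀ i → lookup (b i) i ≡ false) ×
             (∀ i i' → i ≢ i' → Disjoint (canonical b i) (canonical b i'))

isNormal? : ∀ b → Dec (IsNormal b)
isNormal? b =
  (all? λ i → lookup (b i) i ≟ᵇ false) ×-dec
  (all? λ i → all? λ i' → ¬? (i ≟ᶠ i') →-dec disjoint? (canonical b i) (canonical b i'))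

IsNormal-cong : ∀ {b b'} → (∀ i → b i ≡ b' i) → IsNormal b → IsNormal b'
IsNormal-cong b≗b' (low , disjoint) =
  (λ i → subst (λ v → lookup v i ≡ false) (b≗b' i) (low i)) ,
  λ i i' i≢i' → subst₂ Disjoint (cong (edgeAt i) (b≗b' i)) (cong (edgeAt i') (b≗b' i'))
                                (disjoint i i' i≢i')

canonical-cong : ∀ {b b'} → (∀ i → b i ≡ b' i) → canonical b ⊆ᴱ canonical b'
canonical-cong b≗b' i = i , SameEdge-reflexive (cong (edgeAt i) (b≗b' i))

translateNormal : Vertex → (Fin 4 → Vertex) → Fin 4 → Vertex
translateNormal a b i = lowEnd i (a ⊕ b i)

⊕-canonical : ∀ a b i → SameEdge (a ⊕ᴱ canonical b i) (canonical (translateNormal a b) i)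
⊕-canonical a b i =
  subst (λ e → SameEdge e (canonical (translateNormal a b) i)) (sym (⊕ᴱ-edgeAt a i (b i)))
        (edgeAt-lowEnd i (a ⊕ b i))

IsNormal-translate : ∀ a {b} → IsNormal b → IsNormal (translateNormal a b)
IsNormal-translate a {b} (_ , disjoint) =
  (λ i → lowEnd-lookup i (a ⊕ b i)) ,
  λ i i' i≢i' → Disjoint-resp (⊕-canonical a b i) (⊕-canonical a b i')
                              (Disjoint-⊕ a _ _ (disjoint i i' i≢i'))

origin : Vertex
origin = replicate 4 false

translateNormal-origin : ∀ b → translateNormal (b zero) b zero ≡ origin
translateNormal-origin b = cong (lowEnd zero) (⊕-self (b zero))

-- Vertices are coded in binary, coordinate 0 being the least significant bit.
code : Vec Bool n → ℕ
code []       = 0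
code (x ∷ xs) = (if x then 1 else 0) + 2 * code xs

fromCode : (n : ℕ) → ℕ → Vec Bool n
fromCode zero    _ = []
fromCode (suc n) k = (k % 2 ≡ᵇ 1) ∷ fromCode n (k / 2)

cycleOf : Vec ℕ 16 → Fin 16 → Vertex
cycleOf C k = fromCode 4 (lookup C k)

table : ℕ → ℕ → ℕ → List (Vec ℕ 16)
table 4 3 2 =
  (0 ∷ 1 ∷ 3 ∷ 7 ∷ 6 ∷ 4 ∷ 5 ∷ 13 ∷ 12 ∷ 14 ∷ 15 ∷ 11 ∷ 9 ∷ 8 ∷ 10 ∷ 2 ∷ []) ∷
  (0 ∷ 1 ∷ 5 ∷ 7 ∷ 3 ∷ 2 ∷ 10 ∷ 11 ∷ 9 ∷ 13 ∷ 15 ∷ 14 ∷ 6 ∷ 4 ∷ 12 ∷ 8 ∷ []) ∷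
  (0 ∷ 1 ∷ 3 ∷ 7 ∷ 5 ∷ 4 ∷ 6 ∷ 14 ∷ 12 ∷ 8 ∷ 9 ∷ 13 ∷ 15 ∷ 11 ∷ 10 ∷ 2 ∷ []) ∷ []
table 4 3 5 =
  (0 ∷ 1 ∷ 3 ∷ 7 ∷ 6 ∷ 4 ∷ 5 ∷ 13 ∷ 12 ∷ 14 ∷ 15 ∷ 11 ∷ 9 ∷ 8 ∷ 10 ∷ 2 ∷ []) ∷
  (0 ∷ 1 ∷ 5 ∷ 13 ∷ 9 ∷ 11 ∷ 10 ∷ 14 ∷ 15 ∷ 7 ∷ 3 ∷ 2 ∷ 6 ∷ 4 ∷ 12 ∷ 8 ∷ []) ∷
  (0 ∷ 1 ∷ 3 ∷ 7 ∷ 15 ∷ 11 ∷ 10 ∷ 14 ∷ 12 ∷ 8 ∷ 9 ∷ 13 ∷ 5 ∷ 4 ∷ 6 ∷ 2 ∷ []) ∷ []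
table 4 8 2 =
  (0 ∷ 1 ∷ 3 ∷ 2 ∷ 10 ∷ 11 ∷ 9 ∷ 8 ∷ 12 ∷ 13 ∷ 5 ∷ 7 ∷ 15 ∷ 14 ∷ 6 ∷ 4 ∷ []) ∷
  (0 ∷ 1 ∷ 5 ∷ 4 ∷ 6 ∷ 7 ∷ 3 ∷ 11 ∷ 15 ∷ 13 ∷ 9 ∷ 8 ∷ 12 ∷ 14 ∷ 10 ∷ 2 ∷ []) ∷
  (0 ∷ 1 ∷ 3 ∷ 2 ∷ 10 ∷ 11 ∷ 9 ∷ 13 ∷ 15 ∷ 7 ∷ 5 ∷ 4 ∷ 6 ∷ 14 ∷ 12 ∷ 8 ∷ []) ∷ []
table 4 8 3 =
  (0 ∷ 1 ∷ 3 ∷ 11 ∷ 10 ∷ 14 ∷ 15 ∷ 7 ∷ 5 ∷ 13 ∷ 9 ∷ 8 ∷ 12 ∷ 4 ∷ 6 ∷ 2 ∷ []) ∷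
  (0 ∷ 1 ∷ 5 ∷ 4 ∷ 6 ∷ 7 ∷ 3 ∷ 11 ∷ 9 ∷ 13 ∷ 15 ∷ 14 ∷ 12 ∷ 8 ∷ 10 ∷ 2 ∷ []) ∷
  (0 ∷ 1 ∷ 5 ∷ 7 ∷ 15 ∷ 13 ∷ 12 ∷ 8 ∷ 9 ∷ 11 ∷ 3 ∷ 2 ∷ 10 ∷ 14 ∷ 6 ∷ 4 ∷ []) ∷ []
table 4 8 5 =
  (0 ∷ 1 ∷ 3 ∷ 2 ∷ 10 ∷ 11 ∷ 9 ∷ 8 ∷ 12 ∷ 13 ∷ 5 ∷ 7 ∷ 15 ∷ 14 ∷ 6 ∷ 4 ∷ []) ∷
  (0 ∷ 1 ∷ 9 ∷ 13 ∷ 5 ∷ 4 ∷ 6 ∷ 7 ∷ 3 ∷ 11 ∷ 15 ∷ 14 ∷ 12 ∷ 8 ∷ 10 ∷ 2 ∷ []) ∷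
  (0 ∷ 1 ∷ 3 ∷ 7 ∷ 15 ∷ 11 ∷ 10 ∷ 14 ∷ 12 ∷ 8 ∷ 9 ∷ 13 ∷ 5 ∷ 4 ∷ 6 ∷ 2 ∷ []) ∷ []
table 4 8 7 =
  (0 ∷ 1 ∷ 3 ∷ 2 ∷ 6 ∷ 4 ∷ 5 ∷ 7 ∷ 15 ∷ 14 ∷ 10 ∷ 11 ∷ 9 ∷ 13 ∷ 12 ∷ 8 ∷ []) ∷
  (0 ∷ 1 ∷ 5 ∷ 13 ∷ 15 ∷ 7 ∷ 3 ∷ 11 ∷ 9 ∷ 8 ∷ 12 ∷ 4 ∷ 6 ∷ 14 ∷ 10 ∷ 2 ∷ []) ∷
  (0 ∷ 1 ∷ 3 ∷ 2 ∷ 10 ∷ 11 ∷ 15 ∷ 7 ∷ 5 ∷ 13 ∷ 9 ∷ 8 ∷ 12 ∷ 14 ∷ 6 ∷ 4 ∷ []) ∷ []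
table 4 9 2 =
  (0 ∷ 1 ∷ 3 ∷ 2 ∷ 10 ∷ 11 ∷ 9 ∷ 13 ∷ 15 ∷ 7 ∷ 5 ∷ 4 ∷ 6 ∷ 14 ∷ 12 ∷ 8 ∷ []) ∷
  (0 ∷ 1 ∷ 5 ∷ 13 ∷ 9 ∷ 8 ∷ 12 ∷ 4 ∷ 6 ∷ 7 ∷ 3 ∷ 11 ∷ 15 ∷ 14 ∷ 10 ∷ 2 ∷ []) ∷
  (0 ∷ 1 ∷ 3 ∷ 2 ∷ 10 ∷ 11 ∷ 15 ∷ 14 ∷ 12 ∷ 4 ∷ 6 ∷ 7 ∷ 5 ∷ 13 ∷ 9 ∷ 8 ∷ []) ∷ []
table 4 9 3 =
  (0 ∷ 1 ∷ 3 ∷ 11 ∷ 10 ∷ 8 ∷ 9 ∷ 13 ∷ 12 ∷ 14 ∷ 15 ∷ 7 ∷ 5 ∷ 4 ∷ 6 ∷ 2 ∷ []) ∷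
  (0 ∷ 1 ∷ 5 ∷ 7 ∷ 15 ∷ 13 ∷ 9 ∷ 11 ∷ 3 ∷ 2 ∷ 10 ∷ 14 ∷ 6 ∷ 4 ∷ 12 ∷ 8 ∷ []) ∷
  (0 ∷ 1 ∷ 5 ∷ 4 ∷ 6 ∷ 7 ∷ 3 ∷ 11 ∷ 9 ∷ 13 ∷ 15 ∷ 14 ∷ 12 ∷ 8 ∷ 10 ∷ 2 ∷ []) ∷ []
table 4 9 7 =
  (0 ∷ 1 ∷ 3 ∷ 2 ∷ 6 ∷ 4 ∷ 5 ∷ 7 ∷ 15 ∷ 14 ∷ 12 ∷ 13 ∷ 9 ∷ 11 ∷ 10 ∷ 8 ∷ []) ∷
  (0 ∷ 1 ∷ 3 ∷ 11 ∷ 15 ∷ 7 ∷ 5 ∷ 13 ∷ 9 ∷ 8 ∷ 12 ∷ 4 ∷ 6 ∷ 14 ∷ 10 ∷ 2 ∷ []) ∷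
  (0 ∷ 1 ∷ 5 ∷ 4 ∷ 6 ∷ 7 ∷ 15 ∷ 14 ∷ 12 ∷ 13 ∷ 9 ∷ 8 ∷ 10 ∷ 11 ∷ 3 ∷ 2 ∷ []) ∷ []
table 4 10 3 =
  (0 ∷ 1 ∷ 3 ∷ 11 ∷ 10 ∷ 14 ∷ 15 ∷ 7 ∷ 5 ∷ 13 ∷ 9 ∷ 8 ∷ 12 ∷ 4 ∷ 6 ∷ 2 ∷ []) ∷
  (0 ∷ 1 ∷ 5 ∷ 4 ∷ 6 ∷ 7 ∷ 15 ∷ 13 ∷ 12 ∷ 14 ∷ 10 ∷ 2 ∷ 3 ∷ 11 ∷ 9 ∷ 8 ∷ []) ∷
  (0 ∷ 1 ∷ 5 ∷ 7 ∷ 6 ∷ 4 ∷ 12 ∷ 8 ∷ 10 ∷ 14 ∷ 15 ∷ 13 ∷ 9 ∷ 11 ∷ 3 ∷ 2 ∷ []) ∷ []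
table 4 10 5 =
  (0 ∷ 1 ∷ 3 ∷ 2 ∷ 6 ∷ 4 ∷ 12 ∷ 13 ∷ 5 ∷ 7 ∷ 15 ∷ 14 ∷ 10 ∷ 11 ∷ 9 ∷ 8 ∷ []) ∷
  (0 ∷ 1 ∷ 3 ∷ 7 ∷ 6 ∷ 4 ∷ 5 ∷ 13 ∷ 15 ∷ 11 ∷ 9 ∷ 8 ∷ 12 ∷ 14 ∷ 10 ∷ 2 ∷ []) ∷
  (0 ∷ 1 ∷ 9 ∷ 13 ∷ 5 ∷ 4 ∷ 6 ∷ 7 ∷ 15 ∷ 11 ∷ 3 ∷ 2 ∷ 10 ∷ 14 ∷ 12 ∷ 8 ∷ []) ∷ []
table 4 10 7 =
  (0 ∷ 1 ∷ 3 ∷ 2 ∷ 6 ∷ 4 ∷ 5 ∷ 7 ∷ 15 ∷ 14 ∷ 10 ∷ 11 ∷ 9 ∷ 13 ∷ 12 ∷ 8 ∷ []) ∷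
  (0 ∷ 1 ∷ 5 ∷ 13 ∷ 15 ∷ 7 ∷ 6 ∷ 4 ∷ 12 ∷ 14 ∷ 10 ∷ 8 ∷ 9 ∷ 11 ∷ 3 ∷ 2 ∷ []) ∷
  (0 ∷ 1 ∷ 3 ∷ 7 ∷ 15 ∷ 11 ∷ 10 ∷ 14 ∷ 12 ∷ 8 ∷ 9 ∷ 13 ∷ 5 ∷ 4 ∷ 6 ∷ 2 ∷ []) ∷ []
table 4 11 2 =
  (0 ∷ 1 ∷ 3 ∷ 2 ∷ 10 ∷ 11 ∷ 15 ∷ 14 ∷ 12 ∷ 8 ∷ 9 ∷ 13 ∷ 5 ∷ 7 ∷ 6 ∷ 4 ∷ []) ∷
  (0 ∷ 1 ∷ 5 ∷ 4 ∷ 6 ∷ 14 ∷ 12 ∷ 13 ∷ 9 ∷ 11 ∷ 15 ∷ 7 ∷ 3 ∷ 2 ∷ 10 ∷ 8 ∷ []) ∷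
  (0 ∷ 1 ∷ 3 ∷ 7 ∷ 6 ∷ 4 ∷ 5 ∷ 13 ∷ 12 ∷ 8 ∷ 9 ∷ 11 ∷ 15 ∷ 14 ∷ 10 ∷ 2 ∷ []) ∷ []
table 4 11 5 =
  (0 ∷ 1 ∷ 3 ∷ 2 ∷ 6 ∷ 4 ∷ 12 ∷ 14 ∷ 10 ∷ 11 ∷ 15 ∷ 7 ∷ 5 ∷ 13 ∷ 9 ∷ 8 ∷ []) ∷
  (0 ∷ 1 ∷ 9 ∷ 8 ∷ 12 ∷ 13 ∷ 5 ∷ 4 ∷ 6 ∷ 7 ∷ 3 ∷ 11 ∷ 15 ∷ 14 ∷ 10 ∷ 2 ∷ []) ∷
  (0 ∷ 1 ∷ 3 ∷ 2 ∷ 10 ∷ 8 ∷ 12 ∷ 14 ∷ 15 ∷ 11 ∷ 9 ∷ 13 ∷ 5 ∷ 7 ∷ 6 ∷ 4 ∷ []) ∷ []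
table 5 2 3 =
  (0 ∷ 1 ∷ 3 ∷ 11 ∷ 10 ∷ 8 ∷ 9 ∷ 13 ∷ 12 ∷ 14 ∷ 15 ∷ 7 ∷ 5 ∷ 4 ∷ 6 ∷ 2 ∷ []) ∷
  (0 ∷ 1 ∷ 9 ∷ 11 ∷ 3 ∷ 2 ∷ 6 ∷ 7 ∷ 5 ∷ 13 ∷ 15 ∷ 14 ∷ 10 ∷ 8 ∷ 12 ∷ 4 ∷ []) ∷
  (0 ∷ 1 ∷ 3 ∷ 11 ∷ 10 ∷ 14 ∷ 12 ∷ 8 ∷ 9 ∷ 13 ∷ 15 ∷ 7 ∷ 5 ∷ 4 ∷ 6 ∷ 2 ∷ []) ∷ []
table 5 2 4 =
  (0 ∷ 1 ∷ 3 ∷ 2 ∷ 6 ∷ 7 ∷ 5 ∷ 4 ∷ 12 ∷ 13 ∷ 15 ∷ 14 ∷ 10 ∷ 11 ∷ 9 ∷ 8 ∷ []) ∷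
  (0 ∷ 1 ∷ 9 ∷ 13 ∷ 5 ∷ 7 ∷ 3 ∷ 11 ∷ 15 ∷ 14 ∷ 6 ∷ 2 ∷ 10 ∷ 8 ∷ 12 ∷ 4 ∷ []) ∷
  (0 ∷ 1 ∷ 3 ∷ 2 ∷ 6 ∷ 7 ∷ 5 ∷ 4 ∷ 12 ∷ 14 ∷ 10 ∷ 11 ∷ 15 ∷ 13 ∷ 9 ∷ 8 ∷ []) ∷ []
table 5 8 2 =
  (0 ∷ 1 ∷ 3 ∷ 2 ∷ 10 ∷ 11 ∷ 9 ∷ 8 ∷ 12 ∷ 13 ∷ 15 ∷ 14 ∷ 6 ∷ 7 ∷ 5 ∷ 4 ∷ []) ∷
  (0 ∷ 1 ∷ 9 ∷ 13 ∷ 5 ∷ 7 ∷ 3 ∷ 11 ∷ 15 ∷ 14 ∷ 10 ∷ 2 ∷ 6 ∷ 4 ∷ 12 ∷ 8 ∷ []) ∷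
  (0 ∷ 1 ∷ 3 ∷ 2 ∷ 10 ∷ 11 ∷ 9 ∷ 13 ∷ 15 ∷ 7 ∷ 5 ∷ 4 ∷ 6 ∷ 14 ∷ 12 ∷ 8 ∷ []) ∷ []
table 5 8 3 =
  (0 ∷ 1 ∷ 3 ∷ 11 ∷ 10 ∷ 14 ∷ 15 ∷ 13 ∷ 9 ∷ 8 ∷ 12 ∷ 4 ∷ 5 ∷ 7 ∷ 6 ∷ 2 ∷ []) ∷
  (0 ∷ 1 ∷ 9 ∷ 11 ∷ 3 ∷ 2 ∷ 10 ∷ 8 ∷ 12 ∷ 13 ∷ 5 ∷ 7 ∷ 15 ∷ 14 ∷ 6 ∷ 4 ∷ []) ∷
  (0 ∷ 1 ∷ 3 ∷ 11 ∷ 10 ∷ 14 ∷ 12 ∷ 8 ∷ 9 ∷ 13 ∷ 15 ∷ 7 ∷ 5 ∷ 4 ∷ 6 ∷ 2 ∷ []) ∷ []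
table 5 8 6 =
  (0 ∷ 1 ∷ 3 ∷ 2 ∷ 6 ∷ 14 ∷ 15 ∷ 7 ∷ 5 ∷ 13 ∷ 9 ∷ 11 ∷ 10 ∷ 8 ∷ 12 ∷ 4 ∷ []) ∷
  (0 ∷ 1 ∷ 9 ∷ 8 ∷ 12 ∷ 13 ∷ 15 ∷ 11 ∷ 3 ∷ 7 ∷ 5 ∷ 4 ∷ 6 ∷ 14 ∷ 10 ∷ 2 ∷ []) ∷ []
table 5 9 2 =
  (0 ∷ 1 ∷ 3 ∷ 2 ∷ 10 ∷ 11 ∷ 9 ∷ 13 ∷ 15 ∷ 14 ∷ 6 ∷ 7 ∷ 5 ∷ 4 ∷ 12 ∷ 8 ∷ []) ∷
  (0 ∷ 1 ∷ 5 ∷ 7 ∷ 3 ∷ 11 ∷ 15 ∷ 14 ∷ 12 ∷ 13 ∷ 9 ∷ 8 ∷ 10 ∷ 2 ∷ 6 ∷ 4 ∷ []) ∷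
  (0 ∷ 1 ∷ 3 ∷ 2 ∷ 10 ∷ 11 ∷ 9 ∷ 13 ∷ 15 ∷ 7 ∷ 5 ∷ 4 ∷ 6 ∷ 14 ∷ 12 ∷ 8 ∷ []) ∷ []
table 5 9 3 =
  (0 ∷ 1 ∷ 3 ∷ 11 ∷ 10 ∷ 8 ∷ 9 ∷ 13 ∷ 12 ∷ 14 ∷ 15 ∷ 7 ∷ 5 ∷ 4 ∷ 6 ∷ 2 ∷ []) ∷
  (0 ∷ 1 ∷ 5 ∷ 7 ∷ 6 ∷ 14 ∷ 10 ∷ 2 ∷ 3 ∷ 11 ∷ 15 ∷ 13 ∷ 9 ∷ 8 ∷ 12 ∷ 4 ∷ []) ∷
  (0 ∷ 1 ∷ 3 ∷ 11 ∷ 9 ∷ 13 ∷ 12 ∷ 14 ∷ 15 ∷ 7 ∷ 5 ∷ 4 ∷ 6 ∷ 2 ∷ 10 ∷ 8 ∷ []) ∷ []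
table 5 9 4 =
  (0 ∷ 1 ∷ 3 ∷ 2 ∷ 6 ∷ 7 ∷ 5 ∷ 4 ∷ 12 ∷ 13 ∷ 9 ∷ 11 ∷ 15 ∷ 14 ∷ 10 ∷ 8 ∷ []) ∷
  (0 ∷ 1 ∷ 5 ∷ 7 ∷ 3 ∷ 11 ∷ 10 ∷ 2 ∷ 6 ∷ 14 ∷ 15 ∷ 13 ∷ 9 ∷ 8 ∷ 12 ∷ 4 ∷ []) ∷
  (0 ∷ 1 ∷ 3 ∷ 11 ∷ 15 ∷ 13 ∷ 9 ∷ 8 ∷ 12 ∷ 4 ∷ 5 ∷ 7 ∷ 6 ∷ 14 ∷ 10 ∷ 2 ∷ []) ∷ []
table 5 9 6 =
  (0 ∷ 1 ∷ 3 ∷ 2 ∷ 6 ∷ 14 ∷ 15 ∷ 7 ∷ 5 ∷ 4 ∷ 12 ∷ 13 ∷ 9 ∷ 11 ∷ 10 ∷ 8 ∷ []) ∷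
  (0 ∷ 1 ∷ 5 ∷ 7 ∷ 3 ∷ 11 ∷ 15 ∷ 13 ∷ 9 ∷ 8 ∷ 12 ∷ 4 ∷ 6 ∷ 14 ∷ 10 ∷ 2 ∷ []) ∷
  (0 ∷ 1 ∷ 3 ∷ 2 ∷ 6 ∷ 14 ∷ 12 ∷ 13 ∷ 9 ∷ 8 ∷ 10 ∷ 11 ∷ 15 ∷ 7 ∷ 5 ∷ 4 ∷ []) ∷ []
table 5 10 3 =
  (0 ∷ 1 ∷ 3 ∷ 11 ∷ 10 ∷ 14 ∷ 15 ∷ 13 ∷ 9 ∷ 8 ∷ 12 ∷ 4 ∷ 5 ∷ 7 ∷ 6 ∷ 2 ∷ []) ∷
  (0 ∷ 1 ∷ 9 ∷ 8 ∷ 10 ∷ 14 ∷ 12 ∷ 13 ∷ 5 ∷ 7 ∷ 15 ∷ 11 ∷ 3 ∷ 2 ∷ 6 ∷ 4 ∷ []) ∷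
  (0 ∷ 1 ∷ 5 ∷ 7 ∷ 6 ∷ 4 ∷ 12 ∷ 8 ∷ 10 ∷ 14 ∷ 15 ∷ 13 ∷ 9 ∷ 11 ∷ 3 ∷ 2 ∷ []) ∷ []
table 5 10 4 =
  (0 ∷ 1 ∷ 3 ∷ 2 ∷ 6 ∷ 7 ∷ 5 ∷ 4 ∷ 12 ∷ 13 ∷ 15 ∷ 14 ∷ 10 ∷ 11 ∷ 9 ∷ 8 ∷ []) ∷
  (0 ∷ 1 ∷ 3 ∷ 11 ∷ 15 ∷ 7 ∷ 5 ∷ 13 ∷ 9 ∷ 8 ∷ 12 ∷ 4 ∷ 6 ∷ 14 ∷ 10 ∷ 2 ∷ []) ∷
  (0 ∷ 1 ∷ 5 ∷ 7 ∷ 6 ∷ 4 ∷ 12 ∷ 8 ∷ 10 ∷ 14 ∷ 15 ∷ 13 ∷ 9 ∷ 11 ∷ 3 ∷ 2 ∷ []) ∷ []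
table 5 11 2 =
  (0 ∷ 1 ∷ 3 ∷ 2 ∷ 10 ∷ 11 ∷ 15 ∷ 14 ∷ 12 ∷ 8 ∷ 9 ∷ 13 ∷ 5 ∷ 7 ∷ 6 ∷ 4 ∷ []) ∷
  (0 ∷ 1 ∷ 9 ∷ 13 ∷ 12 ∷ 4 ∷ 5 ∷ 7 ∷ 3 ∷ 11 ∷ 15 ∷ 14 ∷ 6 ∷ 2 ∷ 10 ∷ 8 ∷ []) ∷
  (0 ∷ 1 ∷ 3 ∷ 2 ∷ 10 ∷ 8 ∷ 9 ∷ 11 ∷ 15 ∷ 13 ∷ 12 ∷ 14 ∷ 6 ∷ 7 ∷ 5 ∷ 4 ∷ []) ∷ []
table 5 11 4 =
  (0 ∷ 1 ∷ 3 ∷ 2 ∷ 6 ∷ 7 ∷ 5 ∷ 4 ∷ 12 ∷ 13 ∷ 9 ∷ 11 ∷ 15 ∷ 14 ∷ 10 ∷ 8 ∷ []) ∷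
  (0 ∷ 1 ∷ 5 ∷ 7 ∷ 3 ∷ 11 ∷ 15 ∷ 13 ∷ 9 ∷ 8 ∷ 12 ∷ 4 ∷ 6 ∷ 14 ∷ 10 ∷ 2 ∷ []) ∷
  (0 ∷ 1 ∷ 3 ∷ 2 ∷ 10 ∷ 8 ∷ 9 ∷ 11 ∷ 15 ∷ 14 ∷ 6 ∷ 7 ∷ 5 ∷ 13 ∷ 12 ∷ 4 ∷ []) ∷ []
table 5 11 6 =
  (0 ∷ 1 ∷ 3 ∷ 2 ∷ 6 ∷ 14 ∷ 12 ∷ 13 ∷ 9 ∷ 8 ∷ 10 ∷ 11 ∷ 15 ∷ 7 ∷ 5 ∷ 4 ∷ []) ∷
  (0 ∷ 1 ∷ 9 ∷ 11 ∷ 15 ∷ 13 ∷ 5 ∷ 7 ∷ 3 ∷ 2 ∷ 10 ∷ 14 ∷ 6 ∷ 4 ∷ 12 ∷ 8 ∷ []) ∷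
  (0 ∷ 1 ∷ 3 ∷ 7 ∷ 5 ∷ 4 ∷ 6 ∷ 14 ∷ 15 ∷ 11 ∷ 9 ∷ 13 ∷ 12 ∷ 8 ∷ 10 ∷ 2 ∷ []) ∷ []
table 8 2 3 =
  (0 ∷ 1 ∷ 3 ∷ 11 ∷ 10 ∷ 8 ∷ 9 ∷ 13 ∷ 12 ∷ 14 ∷ 15 ∷ 7 ∷ 5 ∷ 4 ∷ 6 ∷ 2 ∷ []) ∷
  (0 ∷ 1 ∷ 9 ∷ 11 ∷ 3 ∷ 2 ∷ 6 ∷ 7 ∷ 5 ∷ 13 ∷ 15 ∷ 14 ∷ 10 ∷ 8 ∷ 12 ∷ 4 ∷ []) ∷
  (0 ∷ 1 ∷ 3 ∷ 11 ∷ 9 ∷ 8 ∷ 10 ∷ 14 ∷ 12 ∷ 4 ∷ 5 ∷ 13 ∷ 15 ∷ 7 ∷ 6 ∷ 2 ∷ []) ∷ []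
table 8 2 4 =
  (0 ∷ 1 ∷ 3 ∷ 2 ∷ 6 ∷ 7 ∷ 5 ∷ 4 ∷ 12 ∷ 13 ∷ 9 ∷ 11 ∷ 15 ∷ 14 ∷ 10 ∷ 8 ∷ []) ∷
  (0 ∷ 1 ∷ 5 ∷ 13 ∷ 15 ∷ 7 ∷ 3 ∷ 11 ∷ 9 ∷ 8 ∷ 10 ∷ 2 ∷ 6 ∷ 14 ∷ 12 ∷ 4 ∷ []) ∷
  (0 ∷ 1 ∷ 3 ∷ 2 ∷ 6 ∷ 7 ∷ 5 ∷ 13 ∷ 9 ∷ 8 ∷ 10 ∷ 11 ∷ 15 ∷ 14 ∷ 12 ∷ 4 ∷ []) ∷ []
table 8 2 5 =
  (0 ∷ 1 ∷ 3 ∷ 2 ∷ 6 ∷ 7 ∷ 5 ∷ 13 ∷ 15 ∷ 11 ∷ 9 ∷ 8 ∷ 10 ∷ 14 ∷ 12 ∷ 4 ∷ []) ∷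
  (0 ∷ 1 ∷ 9 ∷ 13 ∷ 5 ∷ 4 ∷ 12 ∷ 8 ∷ 10 ∷ 11 ∷ 3 ∷ 7 ∷ 15 ∷ 14 ∷ 6 ∷ 2 ∷ []) ∷
  (0 ∷ 1 ∷ 3 ∷ 2 ∷ 6 ∷ 7 ∷ 15 ∷ 14 ∷ 12 ∷ 8 ∷ 10 ∷ 11 ∷ 9 ∷ 13 ∷ 5 ∷ 4 ∷ []) ∷ []
table 8 2 7 =
  (0 ∷ 1 ∷ 3 ∷ 2 ∷ 6 ∷ 7 ∷ 15 ∷ 14 ∷ 12 ∷ 8 ∷ 10 ∷ 11 ∷ 9 ∷ 13 ∷ 5 ∷ 4 ∷ []) ∷
  (0 ∷ 1 ∷ 5 ∷ 4 ∷ 12 ∷ 13 ∷ 15 ∷ 7 ∷ 3 ∷ 11 ∷ 9 ∷ 8 ∷ 10 ∷ 14 ∷ 6 ∷ 2 ∷ []) ∷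
  (0 ∷ 1 ∷ 3 ∷ 11 ∷ 10 ∷ 8 ∷ 9 ∷ 13 ∷ 5 ∷ 7 ∷ 15 ∷ 14 ∷ 12 ∷ 4 ∷ 6 ∷ 2 ∷ []) ∷ []
table 8 3 4 =
  (0 ∷ 1 ∷ 3 ∷ 7 ∷ 6 ∷ 14 ∷ 15 ∷ 11 ∷ 9 ∷ 13 ∷ 5 ∷ 4 ∷ 12 ∷ 8 ∷ 10 ∷ 2 ∷ []) ∷
  (0 ∷ 1 ∷ 5 ∷ 7 ∷ 3 ∷ 2 ∷ 6 ∷ 4 ∷ 12 ∷ 14 ∷ 15 ∷ 13 ∷ 9 ∷ 11 ∷ 10 ∷ 8 ∷ []) ∷
  (0 ∷ 1 ∷ 9 ∷ 8 ∷ 10 ∷ 11 ∷ 15 ∷ 13 ∷ 5 ∷ 4 ∷ 12 ∷ 14 ∷ 6 ∷ 7 ∷ 3 ∷ 2 ∷ []) ∷ []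
table 8 3 5 =
  (0 ∷ 1 ∷ 3 ∷ 7 ∷ 6 ∷ 4 ∷ 5 ∷ 13 ∷ 12 ∷ 14 ∷ 15 ∷ 11 ∷ 9 ∷ 8 ∷ 10 ∷ 2 ∷ []) ∷
  (0 ∷ 1 ∷ 5 ∷ 13 ∷ 9 ∷ 11 ∷ 15 ∷ 7 ∷ 3 ∷ 2 ∷ 6 ∷ 14 ∷ 10 ∷ 8 ∷ 12 ∷ 4 ∷ []) ∷
  (0 ∷ 1 ∷ 5 ∷ 13 ∷ 9 ∷ 8 ∷ 10 ∷ 11 ∷ 3 ∷ 7 ∷ 15 ∷ 14 ∷ 12 ∷ 4 ∷ 6 ∷ 2 ∷ []) ∷ []
table 8 3 6 =
  (0 ∷ 1 ∷ 3 ∷ 7 ∷ 6 ∷ 14 ∷ 15 ∷ 11 ∷ 9 ∷ 13 ∷ 5 ∷ 4 ∷ 12 ∷ 8 ∷ 10 ∷ 2 ∷ []) ∷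
  (0 ∷ 1 ∷ 9 ∷ 8 ∷ 10 ∷ 11 ∷ 15 ∷ 13 ∷ 12 ∷ 14 ∷ 6 ∷ 2 ∷ 3 ∷ 7 ∷ 5 ∷ 4 ∷ []) ∷
  (0 ∷ 1 ∷ 5 ∷ 7 ∷ 3 ∷ 2 ∷ 6 ∷ 14 ∷ 15 ∷ 13 ∷ 9 ∷ 11 ∷ 10 ∷ 8 ∷ 12 ∷ 4 ∷ []) ∷ []
table 8 9 3 =
  (0 ∷ 1 ∷ 3 ∷ 11 ∷ 10 ∷ 8 ∷ 9 ∷ 13 ∷ 12 ∷ 14 ∷ 15 ∷ 7 ∷ 5 ∷ 4 ∷ 6 ∷ 2 ∷ []) ∷
  (0 ∷ 1 ∷ 5 ∷ 7 ∷ 6 ∷ 14 ∷ 15 ∷ 13 ∷ 9 ∷ 11 ∷ 3 ∷ 2 ∷ 10 ∷ 8 ∷ 12 ∷ 4 ∷ []) ∷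
  (0 ∷ 1 ∷ 3 ∷ 11 ∷ 15 ∷ 7 ∷ 6 ∷ 14 ∷ 12 ∷ 4 ∷ 5 ∷ 13 ∷ 9 ∷ 8 ∷ 10 ∷ 2 ∷ []) ∷ []
table 8 9 4 =
  (0 ∷ 1 ∷ 3 ∷ 2 ∷ 6 ∷ 7 ∷ 5 ∷ 4 ∷ 12 ∷ 13 ∷ 9 ∷ 11 ∷ 15 ∷ 14 ∷ 10 ∷ 8 ∷ []) ∷
  (0 ∷ 1 ∷ 5 ∷ 13 ∷ 9 ∷ 8 ∷ 10 ∷ 11 ∷ 3 ∷ 7 ∷ 15 ∷ 14 ∷ 12 ∷ 4 ∷ 6 ∷ 2 ∷ []) ∷
  (0 ∷ 1 ∷ 3 ∷ 11 ∷ 15 ∷ 7 ∷ 6 ∷ 14 ∷ 12 ∷ 4 ∷ 5 ∷ 13 ∷ 9 ∷ 8 ∷ 10 ∷ 2 ∷ []) ∷ []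
table 8 9 6 =
  (0 ∷ 1 ∷ 3 ∷ 2 ∷ 6 ∷ 14 ∷ 15 ∷ 7 ∷ 5 ∷ 4 ∷ 12 ∷ 13 ∷ 9 ∷ 11 ∷ 10 ∷ 8 ∷ []) ∷
  (0 ∷ 1 ∷ 5 ∷ 4 ∷ 12 ∷ 14 ∷ 6 ∷ 7 ∷ 3 ∷ 11 ∷ 15 ∷ 13 ∷ 9 ∷ 8 ∷ 10 ∷ 2 ∷ []) ∷
  (0 ∷ 1 ∷ 5 ∷ 7 ∷ 3 ∷ 2 ∷ 10 ∷ 8 ∷ 12 ∷ 13 ∷ 9 ∷ 11 ∷ 15 ∷ 14 ∷ 6 ∷ 4 ∷ []) ∷ []
table 8 9 7 =
  (0 ∷ 1 ∷ 3 ∷ 2 ∷ 6 ∷ 7 ∷ 15 ∷ 14 ∷ 12 ∷ 8 ∷ 10 ∷ 11 ∷ 9 ∷ 13 ∷ 5 ∷ 4 ∷ []) ∷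
  (0 ∷ 1 ∷ 3 ∷ 11 ∷ 15 ∷ 7 ∷ 5 ∷ 4 ∷ 6 ∷ 14 ∷ 12 ∷ 13 ∷ 9 ∷ 8 ∷ 10 ∷ 2 ∷ []) ∷
  (0 ∷ 1 ∷ 5 ∷ 7 ∷ 15 ∷ 14 ∷ 10 ∷ 8 ∷ 12 ∷ 13 ∷ 9 ∷ 11 ∷ 3 ∷ 2 ∷ 6 ∷ 4 ∷ []) ∷ []
table 8 11 4 =
  (0 ∷ 1 ∷ 3 ∷ 2 ∷ 6 ∷ 7 ∷ 5 ∷ 4 ∷ 12 ∷ 13 ∷ 9 ∷ 11 ∷ 15 ∷ 14 ∷ 10 ∷ 8 ∷ []) ∷
  (0 ∷ 1 ∷ 5 ∷ 4 ∷ 12 ∷ 14 ∷ 6 ∷ 7 ∷ 3 ∷ 11 ∷ 15 ∷ 13 ∷ 9 ∷ 8 ∷ 10 ∷ 2 ∷ []) ∷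
  (0 ∷ 1 ∷ 3 ∷ 2 ∷ 6 ∷ 14 ∷ 10 ∷ 8 ∷ 9 ∷ 11 ∷ 15 ∷ 7 ∷ 5 ∷ 13 ∷ 12 ∷ 4 ∷ []) ∷ []
table 8 11 5 =
  (0 ∷ 1 ∷ 3 ∷ 2 ∷ 6 ∷ 7 ∷ 5 ∷ 13 ∷ 15 ∷ 11 ∷ 9 ∷ 8 ∷ 10 ∷ 14 ∷ 12 ∷ 4 ∷ []) ∷
  (0 ∷ 1 ∷ 9 ∷ 13 ∷ 5 ∷ 4 ∷ 6 ∷ 7 ∷ 3 ∷ 11 ∷ 15 ∷ 14 ∷ 12 ∷ 8 ∷ 10 ∷ 2 ∷ []) ∷
  (0 ∷ 1 ∷ 3 ∷ 2 ∷ 6 ∷ 14 ∷ 10 ∷ 8 ∷ 9 ∷ 11 ∷ 15 ∷ 7 ∷ 5 ∷ 13 ∷ 12 ∷ 4 ∷ []) ∷ []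
table 8 11 6 =
  (0 ∷ 1 ∷ 3 ∷ 2 ∷ 6 ∷ 14 ∷ 12 ∷ 13 ∷ 9 ∷ 8 ∷ 10 ∷ 11 ∷ 15 ∷ 7 ∷ 5 ∷ 4 ∷ []) ∷
  (0 ∷ 1 ∷ 9 ∷ 11 ∷ 15 ∷ 13 ∷ 5 ∷ 4 ∷ 12 ∷ 8 ∷ 10 ∷ 14 ∷ 6 ∷ 7 ∷ 3 ∷ 2 ∷ []) ∷
  (0 ∷ 1 ∷ 3 ∷ 7 ∷ 5 ∷ 13 ∷ 12 ∷ 4 ∷ 6 ∷ 14 ∷ 15 ∷ 11 ∷ 9 ∷ 8 ∷ 10 ∷ 2 ∷ []) ∷ []
table 9 2 4 =
  (0 ∷ 1 ∷ 3 ∷ 2 ∷ 6 ∷ 7 ∷ 5 ∷ 4 ∷ 12 ∷ 13 ∷ 15 ∷ 14 ∷ 10 ∷ 11 ∷ 9 ∷ 8 ∷ []) ∷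
  (0 ∷ 1 ∷ 5 ∷ 13 ∷ 9 ∷ 11 ∷ 3 ∷ 7 ∷ 15 ∷ 14 ∷ 6 ∷ 2 ∷ 10 ∷ 8 ∷ 12 ∷ 4 ∷ []) ∷
  (0 ∷ 1 ∷ 3 ∷ 2 ∷ 6 ∷ 7 ∷ 5 ∷ 13 ∷ 15 ∷ 11 ∷ 9 ∷ 8 ∷ 10 ∷ 14 ∷ 12 ∷ 4 ∷ []) ∷ []
table 9 2 5 =
  (0 ∷ 1 ∷ 3 ∷ 2 ∷ 6 ∷ 7 ∷ 5 ∷ 13 ∷ 15 ∷ 14 ∷ 10 ∷ 11 ∷ 9 ∷ 8 ∷ 12 ∷ 4 ∷ []) ∷
  (0 ∷ 1 ∷ 9 ∷ 11 ∷ 3 ∷ 7 ∷ 15 ∷ 14 ∷ 12 ∷ 13 ∷ 5 ∷ 4 ∷ 6 ∷ 2 ∷ 10 ∷ 8 ∷ []) ∷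
  (0 ∷ 1 ∷ 3 ∷ 2 ∷ 6 ∷ 7 ∷ 5 ∷ 13 ∷ 15 ∷ 11 ∷ 9 ∷ 8 ∷ 10 ∷ 14 ∷ 12 ∷ 4 ∷ []) ∷ []
table 9 2 7 =
  (0 ∷ 1 ∷ 3 ∷ 2 ∷ 6 ∷ 7 ∷ 15 ∷ 14 ∷ 12 ∷ 8 ∷ 10 ∷ 11 ∷ 9 ∷ 13 ∷ 5 ∷ 4 ∷ []) ∷
  (0 ∷ 1 ∷ 5 ∷ 4 ∷ 6 ∷ 2 ∷ 10 ∷ 14 ∷ 12 ∷ 13 ∷ 15 ∷ 7 ∷ 3 ∷ 11 ∷ 9 ∷ 8 ∷ []) ∷
  (0 ∷ 1 ∷ 3 ∷ 2 ∷ 6 ∷ 4 ∷ 12 ∷ 13 ∷ 5 ∷ 7 ∷ 15 ∷ 14 ∷ 10 ∷ 11 ∷ 9 ∷ 8 ∷ []) ∷ []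
table 9 3 2 =
  (0 ∷ 1 ∷ 3 ∷ 7 ∷ 6 ∷ 4 ∷ 5 ∷ 13 ∷ 12 ∷ 14 ∷ 15 ∷ 11 ∷ 9 ∷ 8 ∷ 10 ∷ 2 ∷ []) ∷
  (0 ∷ 1 ∷ 5 ∷ 7 ∷ 3 ∷ 2 ∷ 10 ∷ 11 ∷ 9 ∷ 13 ∷ 15 ∷ 14 ∷ 6 ∷ 4 ∷ 12 ∷ 8 ∷ []) ∷
  (0 ∷ 1 ∷ 3 ∷ 7 ∷ 6 ∷ 2 ∷ 10 ∷ 14 ∷ 12 ∷ 8 ∷ 9 ∷ 11 ∷ 15 ∷ 13 ∷ 5 ∷ 4 ∷ []) ∷ []
table 9 3 4 =
  (0 ∷ 1 ∷ 3 ∷ 7 ∷ 6 ∷ 2 ∷ 10 ∷ 14 ∷ 15 ∷ 11 ∷ 9 ∷ 13 ∷ 5 ∷ 4 ∷ 12 ∷ 8 ∷ []) ∷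
  (0 ∷ 1 ∷ 5 ∷ 4 ∷ 12 ∷ 13 ∷ 15 ∷ 7 ∷ 3 ∷ 11 ∷ 9 ∷ 8 ∷ 10 ∷ 14 ∷ 6 ∷ 2 ∷ []) ∷
  (0 ∷ 1 ∷ 3 ∷ 7 ∷ 5 ∷ 13 ∷ 12 ∷ 4 ∷ 6 ∷ 14 ∷ 15 ∷ 11 ∷ 9 ∷ 8 ∷ 10 ∷ 2 ∷ []) ∷ []
table 9 3 5 =
  (0 ∷ 1 ∷ 3 ∷ 7 ∷ 6 ∷ 4 ∷ 5 ∷ 13 ∷ 12 ∷ 14 ∷ 15 ∷ 11 ∷ 9 ∷ 8 ∷ 10 ∷ 2 ∷ []) ∷
  (0 ∷ 1 ∷ 5 ∷ 13 ∷ 15 ∷ 7 ∷ 3 ∷ 2 ∷ 6 ∷ 14 ∷ 10 ∷ 11 ∷ 9 ∷ 8 ∷ 12 ∷ 4 ∷ []) ∷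
  (0 ∷ 1 ∷ 3 ∷ 7 ∷ 6 ∷ 4 ∷ 5 ∷ 13 ∷ 9 ∷ 11 ∷ 15 ∷ 14 ∷ 12 ∷ 8 ∷ 10 ∷ 2 ∷ []) ∷ []
table 9 3 6 =
  (0 ∷ 1 ∷ 3 ∷ 7 ∷ 6 ∷ 14 ∷ 15 ∷ 13 ∷ 5 ∷ 4 ∷ 12 ∷ 8 ∷ 9 ∷ 11 ∷ 10 ∷ 2 ∷ []) ∷
  (0 ∷ 1 ∷ 5 ∷ 4 ∷ 6 ∷ 14 ∷ 12 ∷ 13 ∷ 9 ∷ 11 ∷ 15 ∷ 7 ∷ 3 ∷ 2 ∷ 10 ∷ 8 ∷ []) ∷
  (0 ∷ 1 ∷ 5 ∷ 7 ∷ 3 ∷ 2 ∷ 6 ∷ 14 ∷ 15 ∷ 13 ∷ 9 ∷ 11 ∷ 10 ∷ 8 ∷ 12 ∷ 4 ∷ []) ∷ []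
table 9 8 2 =
  (0 ∷ 1 ∷ 3 ∷ 2 ∷ 10 ∷ 11 ∷ 9 ∷ 8 ∷ 12 ∷ 13 ∷ 15 ∷ 14 ∷ 6 ∷ 7 ∷ 5 ∷ 4 ∷ []) ∷
  (0 ∷ 1 ∷ 5 ∷ 13 ∷ 9 ∷ 11 ∷ 3 ∷ 7 ∷ 15 ∷ 14 ∷ 10 ∷ 2 ∷ 6 ∷ 4 ∷ 12 ∷ 8 ∷ []) ∷
  (0 ∷ 1 ∷ 3 ∷ 2 ∷ 10 ∷ 11 ∷ 9 ∷ 8 ∷ 12 ∷ 14 ∷ 6 ∷ 7 ∷ 15 ∷ 13 ∷ 5 ∷ 4 ∷ []) ∷ []
table 9 8 5 =
  (0 ∷ 1 ∷ 3 ∷ 2 ∷ 6 ∷ 7 ∷ 5 ∷ 13 ∷ 15 ∷ 14 ∷ 10 ∷ 11 ∷ 9 ∷ 8 ∷ 12 ∷ 4 ∷ []) ∷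
  (0 ∷ 1 ∷ 3 ∷ 7 ∷ 15 ∷ 11 ∷ 9 ∷ 13 ∷ 5 ∷ 4 ∷ 6 ∷ 14 ∷ 12 ∷ 8 ∷ 10 ∷ 2 ∷ []) ∷
  (0 ∷ 1 ∷ 5 ∷ 13 ∷ 12 ∷ 8 ∷ 9 ∷ 11 ∷ 10 ∷ 14 ∷ 15 ∷ 7 ∷ 3 ∷ 2 ∷ 6 ∷ 4 ∷ []) ∷ []
table 9 8 6 =
  (0 ∷ 1 ∷ 3 ∷ 2 ∷ 6 ∷ 14 ∷ 15 ∷ 7 ∷ 5 ∷ 13 ∷ 9 ∷ 11 ∷ 10 ∷ 8 ∷ 12 ∷ 4 ∷ []) ∷
  (0 ∷ 1 ∷ 3 ∷ 7 ∷ 15 ∷ 11 ∷ 9 ∷ 8 ∷ 12 ∷ 13 ∷ 5 ∷ 4 ∷ 6 ∷ 14 ∷ 10 ∷ 2 ∷ []) ∷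
  (0 ∷ 1 ∷ 5 ∷ 4 ∷ 12 ∷ 8 ∷ 10 ∷ 11 ∷ 9 ∷ 13 ∷ 15 ∷ 14 ∷ 6 ∷ 7 ∷ 3 ∷ 2 ∷ []) ∷ []
table 9 8 7 =
  (0 ∷ 1 ∷ 3 ∷ 2 ∷ 6 ∷ 7 ∷ 15 ∷ 14 ∷ 12 ∷ 8 ∷ 10 ∷ 11 ∷ 9 ∷ 13 ∷ 5 ∷ 4 ∷ []) ∷
  (0 ∷ 1 ∷ 5 ∷ 13 ∷ 15 ∷ 7 ∷ 3 ∷ 11 ∷ 9 ∷ 8 ∷ 12 ∷ 4 ∷ 6 ∷ 14 ∷ 10 ∷ 2 ∷ []) ∷
  (0 ∷ 1 ∷ 3 ∷ 2 ∷ 6 ∷ 4 ∷ 5 ∷ 7 ∷ 15 ∷ 14 ∷ 10 ∷ 11 ∷ 9 ∷ 13 ∷ 12 ∷ 8 ∷ []) ∷ []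
table 9 10 4 =
  (0 ∷ 1 ∷ 3 ∷ 2 ∷ 6 ∷ 7 ∷ 5 ∷ 4 ∷ 12 ∷ 13 ∷ 15 ∷ 14 ∷ 10 ∷ 11 ∷ 9 ∷ 8 ∷ []) ∷
  (0 ∷ 1 ∷ 5 ∷ 13 ∷ 15 ∷ 7 ∷ 3 ∷ 11 ∷ 9 ∷ 8 ∷ 12 ∷ 4 ∷ 6 ∷ 14 ∷ 10 ∷ 2 ∷ []) ∷
  (0 ∷ 1 ∷ 3 ∷ 2 ∷ 6 ∷ 7 ∷ 5 ∷ 4 ∷ 12 ∷ 13 ∷ 9 ∷ 11 ∷ 15 ∷ 14 ∷ 10 ∷ 8 ∷ []) ∷ []
table 9 10 5 =
  (0 ∷ 1 ∷ 3 ∷ 2 ∷ 6 ∷ 7 ∷ 5 ∷ 13 ∷ 15 ∷ 14 ∷ 10 ∷ 11 ∷ 9 ∷ 8 ∷ 12 ∷ 4 ∷ []) ∷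
  (0 ∷ 1 ∷ 9 ∷ 11 ∷ 15 ∷ 7 ∷ 3 ∷ 2 ∷ 6 ∷ 4 ∷ 5 ∷ 13 ∷ 12 ∷ 14 ∷ 10 ∷ 8 ∷ []) ∷
  (0 ∷ 1 ∷ 3 ∷ 7 ∷ 6 ∷ 4 ∷ 5 ∷ 13 ∷ 12 ∷ 8 ∷ 9 ∷ 11 ∷ 15 ∷ 14 ∷ 10 ∷ 2 ∷ []) ∷ []
table 9 10 7 =
  (0 ∷ 1 ∷ 3 ∷ 2 ∷ 6 ∷ 7 ∷ 15 ∷ 14 ∷ 10 ∷ 11 ∷ 9 ∷ 8 ∷ 12 ∷ 13 ∷ 5 ∷ 4 ∷ []) ∷
  (0 ∷ 1 ∷ 5 ∷ 7 ∷ 15 ∷ 13 ∷ 9 ∷ 11 ∷ 3 ∷ 2 ∷ 6 ∷ 4 ∷ 12 ∷ 14 ∷ 10 ∷ 8 ∷ []) ∷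
  (0 ∷ 1 ∷ 3 ∷ 7 ∷ 15 ∷ 11 ∷ 9 ∷ 8 ∷ 12 ∷ 13 ∷ 5 ∷ 4 ∷ 6 ∷ 14 ∷ 10 ∷ 2 ∷ []) ∷ []
table 12 2 3 =
  (0 ∷ 1 ∷ 3 ∷ 11 ∷ 10 ∷ 8 ∷ 9 ∷ 13 ∷ 12 ∷ 14 ∷ 15 ∷ 7 ∷ 5 ∷ 4 ∷ 6 ∷ 2 ∷ []) ∷
  (0 ∷ 1 ∷ 9 ∷ 8 ∷ 12 ∷ 14 ∷ 10 ∷ 2 ∷ 6 ∷ 7 ∷ 3 ∷ 11 ∷ 15 ∷ 13 ∷ 5 ∷ 4 ∷ []) ∷
  (0 ∷ 1 ∷ 3 ∷ 11 ∷ 9 ∷ 13 ∷ 5 ∷ 7 ∷ 15 ∷ 14 ∷ 12 ∷ 8 ∷ 10 ∷ 2 ∷ 6 ∷ 4 ∷ []) ∷ []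
table 12 2 5 =
  (0 ∷ 1 ∷ 3 ∷ 2 ∷ 6 ∷ 7 ∷ 5 ∷ 13 ∷ 15 ∷ 11 ∷ 9 ∷ 8 ∷ 10 ∷ 14 ∷ 12 ∷ 4 ∷ []) ∷
  (0 ∷ 1 ∷ 9 ∷ 13 ∷ 5 ∷ 4 ∷ 6 ∷ 2 ∷ 10 ∷ 11 ∷ 3 ∷ 7 ∷ 15 ∷ 14 ∷ 12 ∷ 8 ∷ []) ∷ []
table 12 2 7 =
  (0 ∷ 1 ∷ 3 ∷ 2 ∷ 6 ∷ 7 ∷ 15 ∷ 14 ∷ 12 ∷ 8 ∷ 10 ∷ 11 ∷ 9 ∷ 13 ∷ 5 ∷ 4 ∷ []) ∷
  (0 ∷ 1 ∷ 5 ∷ 4 ∷ 6 ∷ 2 ∷ 10 ∷ 14 ∷ 12 ∷ 13 ∷ 15 ∷ 7 ∷ 3 ∷ 11 ∷ 9 ∷ 8 ∷ []) ∷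
  (0 ∷ 1 ∷ 3 ∷ 2 ∷ 6 ∷ 4 ∷ 12 ∷ 14 ∷ 10 ∷ 11 ∷ 15 ∷ 7 ∷ 5 ∷ 13 ∷ 9 ∷ 8 ∷ []) ∷ []
table 12 3 2 =
  (0 ∷ 1 ∷ 3 ∷ 7 ∷ 6 ∷ 4 ∷ 5 ∷ 13 ∷ 12 ∷ 14 ∷ 15 ∷ 11 ∷ 9 ∷ 8 ∷ 10 ∷ 2 ∷ []) ∷
  (0 ∷ 1 ∷ 5 ∷ 4 ∷ 12 ∷ 14 ∷ 6 ∷ 2 ∷ 10 ∷ 11 ∷ 3 ∷ 7 ∷ 15 ∷ 13 ∷ 9 ∷ 8 ∷ []) ∷
  (0 ∷ 1 ∷ 3 ∷ 7 ∷ 5 ∷ 13 ∷ 9 ∷ 11 ∷ 15 ∷ 14 ∷ 12 ∷ 8 ∷ 10 ∷ 2 ∷ 6 ∷ 4 ∷ []) ∷ []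
table 12 3 5 =
  (0 ∷ 1 ∷ 3 ∷ 7 ∷ 6 ∷ 4 ∷ 5 ∷ 13 ∷ 12 ∷ 14 ∷ 15 ∷ 11 ∷ 9 ∷ 8 ∷ 10 ∷ 2 ∷ []) ∷
  (0 ∷ 1 ∷ 5 ∷ 13 ∷ 15 ∷ 7 ∷ 3 ∷ 2 ∷ 6 ∷ 4 ∷ 12 ∷ 14 ∷ 10 ∷ 11 ∷ 9 ∷ 8 ∷ []) ∷
  (0 ∷ 1 ∷ 9 ∷ 13 ∷ 5 ∷ 4 ∷ 12 ∷ 14 ∷ 15 ∷ 11 ∷ 3 ∷ 7 ∷ 6 ∷ 2 ∷ 10 ∷ 8 ∷ []) ∷ []
table 12 9 2 =
  (0 ∷ 1 ∷ 3 ∷ 2 ∷ 10 ∷ 11 ∷ 9 ∷ 13 ∷ 15 ∷ 7 ∷ 5 ∷ 4 ∷ 6 ∷ 14 ∷ 12 ∷ 8 ∷ []) ∷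
  (0 ∷ 1 ∷ 5 ∷ 13 ∷ 9 ∷ 8 ∷ 10 ∷ 2 ∷ 6 ∷ 7 ∷ 3 ∷ 11 ∷ 15 ∷ 14 ∷ 12 ∷ 4 ∷ []) ∷ []
table 12 9 3 =
  (0 ∷ 1 ∷ 3 ∷ 11 ∷ 10 ∷ 8 ∷ 9 ∷ 13 ∷ 12 ∷ 14 ∷ 15 ∷ 7 ∷ 5 ∷ 4 ∷ 6 ∷ 2 ∷ []) ∷
  (0 ∷ 1 ∷ 5 ∷ 4 ∷ 6 ∷ 7 ∷ 15 ∷ 13 ∷ 9 ∷ 11 ∷ 3 ∷ 2 ∷ 10 ∷ 14 ∷ 12 ∷ 8 ∷ []) ∷
  (0 ∷ 1 ∷ 5 ∷ 7 ∷ 6 ∷ 2 ∷ 3 ∷ 11 ∷ 10 ∷ 8 ∷ 9 ∷ 13 ∷ 15 ∷ 14 ∷ 12 ∷ 4 ∷ []) ∷ []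
table 12 9 7 =
  (0 ∷ 1 ∷ 3 ∷ 2 ∷ 6 ∷ 7 ∷ 15 ∷ 14 ∷ 12 ∷ 8 ∷ 10 ∷ 11 ∷ 9 ∷ 13 ∷ 5 ∷ 4 ∷ []) ∷
  (0 ∷ 1 ∷ 3 ∷ 11 ∷ 15 ∷ 7 ∷ 5 ∷ 4 ∷ 6 ∷ 2 ∷ 10 ∷ 14 ∷ 12 ∷ 13 ∷ 9 ∷ 8 ∷ []) ∷
  (0 ∷ 1 ∷ 5 ∷ 7 ∷ 15 ∷ 13 ∷ 9 ∷ 11 ∷ 3 ∷ 2 ∷ 10 ∷ 8 ∷ 12 ∷ 14 ∷ 6 ∷ 4 ∷ []) ∷ []
table 12 11 2 =
  (0 ∷ 1 ∷ 3 ∷ 2 ∷ 10 ∷ 11 ∷ 15 ∷ 14 ∷ 12 ∷ 8 ∷ 9 ∷ 13 ∷ 5 ∷ 7 ∷ 6 ∷ 4 ∷ []) ∷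
  (0 ∷ 1 ∷ 9 ∷ 13 ∷ 15 ∷ 11 ∷ 3 ∷ 7 ∷ 5 ∷ 4 ∷ 12 ∷ 14 ∷ 6 ∷ 2 ∷ 10 ∷ 8 ∷ []) ∷
  (0 ∷ 1 ∷ 3 ∷ 2 ∷ 10 ∷ 8 ∷ 9 ∷ 11 ∷ 15 ∷ 7 ∷ 6 ∷ 14 ∷ 12 ∷ 13 ∷ 5 ∷ 4 ∷ []) ∷ []
table 12 11 5 =
  (0 ∷ 1 ∷ 3 ∷ 2 ∷ 6 ∷ 7 ∷ 5 ∷ 13 ∷ 15 ∷ 11 ∷ 9 ∷ 8 ∷ 10 ∷ 14 ∷ 12 ∷ 4 ∷ []) ∷
  (0 ∷ 1 ∷ 9 ∷ 13 ∷ 5 ∷ 4 ∷ 6 ∷ 7 ∷ 3 ∷ 2 ∷ 10 ∷ 11 ∷ 15 ∷ 14 ∷ 12 ∷ 8 ∷ []) ∷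
  (0 ∷ 1 ∷ 3 ∷ 7 ∷ 5 ∷ 13 ∷ 12 ∷ 14 ∷ 15 ∷ 11 ∷ 9 ∷ 8 ∷ 10 ∷ 2 ∷ 6 ∷ 4 ∷ []) ∷ []
table 13 2 3 =
  (0 ∷ 1 ∷ 3 ∷ 11 ∷ 10 ∷ 8 ∷ 9 ∷ 13 ∷ 15 ∷ 14 ∷ 12 ∷ 4 ∷ 5 ∷ 7 ∷ 6 ∷ 2 ∷ []) ∷
  (0 ∷ 1 ∷ 5 ∷ 13 ∷ 15 ∷ 7 ∷ 3 ∷ 11 ∷ 9 ∷ 8 ∷ 12 ∷ 14 ∷ 10 ∷ 2 ∷ 6 ∷ 4 ∷ []) ∷
  (0 ∷ 1 ∷ 3 ∷ 11 ∷ 9 ∷ 13 ∷ 15 ∷ 14 ∷ 10 ∷ 8 ∷ 12 ∷ 4 ∷ 5 ∷ 7 ∷ 6 ∷ 2 ∷ []) ∷ []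
table 13 2 4 =
  (0 ∷ 1 ∷ 3 ∷ 2 ∷ 6 ∷ 7 ∷ 5 ∷ 4 ∷ 12 ∷ 13 ∷ 15 ∷ 14 ∷ 10 ∷ 11 ∷ 9 ∷ 8 ∷ []) ∷
  (0 ∷ 1 ∷ 5 ∷ 7 ∷ 3 ∷ 11 ∷ 15 ∷ 13 ∷ 9 ∷ 8 ∷ 10 ∷ 2 ∷ 6 ∷ 14 ∷ 12 ∷ 4 ∷ []) ∷
  (0 ∷ 1 ∷ 5 ∷ 4 ∷ 12 ∷ 14 ∷ 15 ∷ 13 ∷ 9 ∷ 11 ∷ 3 ∷ 7 ∷ 6 ∷ 2 ∷ 10 ∷ 8 ∷ []) ∷ []
table 13 3 2 =
  (0 ∷ 1 ∷ 3 ∷ 7 ∷ 6 ∷ 4 ∷ 5 ∷ 13 ∷ 15 ∷ 14 ∷ 12 ∷ 8 ∷ 9 ∷ 11 ∷ 10 ∷ 2 ∷ []) ∷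
  (0 ∷ 1 ∷ 5 ∷ 7 ∷ 3 ∷ 11 ∷ 15 ∷ 13 ∷ 9 ∷ 8 ∷ 10 ∷ 2 ∷ 6 ∷ 14 ∷ 12 ∷ 4 ∷ []) ∷
  (0 ∷ 1 ∷ 5 ∷ 7 ∷ 3 ∷ 2 ∷ 10 ∷ 11 ∷ 9 ∷ 13 ∷ 15 ∷ 14 ∷ 6 ∷ 4 ∷ 12 ∷ 8 ∷ []) ∷ []
table 13 3 4 =
  (0 ∷ 1 ∷ 3 ∷ 7 ∷ 6 ∷ 2 ∷ 10 ∷ 14 ∷ 12 ∷ 4 ∷ 5 ∷ 13 ∷ 15 ∷ 11 ∷ 9 ∷ 8 ∷ []) ∷
  (0 ∷ 1 ∷ 5 ∷ 7 ∷ 3 ∷ 2 ∷ 6 ∷ 14 ∷ 15 ∷ 13 ∷ 9 ∷ 11 ∷ 10 ∷ 8 ∷ 12 ∷ 4 ∷ []) ∷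
  (0 ∷ 1 ∷ 5 ∷ 4 ∷ 12 ∷ 14 ∷ 6 ∷ 7 ∷ 3 ∷ 2 ∷ 10 ∷ 11 ∷ 15 ∷ 13 ∷ 9 ∷ 8 ∷ []) ∷ []
table 13 3 6 =
  (0 ∷ 1 ∷ 3 ∷ 7 ∷ 6 ∷ 14 ∷ 15 ∷ 13 ∷ 5 ∷ 4 ∷ 12 ∷ 8 ∷ 9 ∷ 11 ∷ 10 ∷ 2 ∷ []) ∷
  (0 ∷ 1 ∷ 5 ∷ 7 ∷ 3 ∷ 2 ∷ 6 ∷ 14 ∷ 10 ∷ 8 ∷ 9 ∷ 11 ∷ 15 ∷ 13 ∷ 12 ∷ 4 ∷ []) ∷
  (0 ∷ 1 ∷ 9 ∷ 13 ∷ 15 ∷ 11 ∷ 10 ∷ 8 ∷ 12 ∷ 14 ∷ 6 ∷ 4 ∷ 5 ∷ 7 ∷ 3 ∷ 2 ∷ []) ∷ []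
table 13 8 2 =
  (0 ∷ 1 ∷ 3 ∷ 2 ∷ 10 ∷ 11 ∷ 9 ∷ 8 ∷ 12 ∷ 13 ∷ 15 ∷ 14 ∷ 6 ∷ 7 ∷ 5 ∷ 4 ∷ []) ∷
  (0 ∷ 1 ∷ 9 ∷ 11 ∷ 3 ∷ 7 ∷ 15 ∷ 13 ∷ 5 ∷ 4 ∷ 6 ∷ 2 ∷ 10 ∷ 14 ∷ 12 ∷ 8 ∷ []) ∷
  (0 ∷ 1 ∷ 5 ∷ 7 ∷ 6 ∷ 14 ∷ 10 ∷ 2 ∷ 3 ∷ 11 ∷ 15 ∷ 13 ∷ 9 ∷ 8 ∷ 12 ∷ 4 ∷ []) ∷ []
table 13 8 3 =
  (0 ∷ 1 ∷ 3 ∷ 11 ∷ 10 ∷ 14 ∷ 15 ∷ 13 ∷ 9 ∷ 8 ∷ 12 ∷ 4 ∷ 5 ∷ 7 ∷ 6 ∷ 2 ∷ []) ∷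
  (0 ∷ 1 ∷ 5 ∷ 7 ∷ 15 ∷ 13 ∷ 9 ∷ 11 ∷ 3 ∷ 2 ∷ 10 ∷ 8 ∷ 12 ∷ 14 ∷ 6 ∷ 4 ∷ []) ∷
  (0 ∷ 1 ∷ 3 ∷ 11 ∷ 9 ∷ 8 ∷ 12 ∷ 14 ∷ 10 ∷ 2 ∷ 6 ∷ 7 ∷ 15 ∷ 13 ∷ 5 ∷ 4 ∷ []) ∷ []
table 13 8 6 =
  (0 ∷ 1 ∷ 3 ∷ 2 ∷ 6 ∷ 14 ∷ 12 ∷ 8 ∷ 10 ∷ 11 ∷ 9 ∷ 13 ∷ 15 ∷ 7 ∷ 5 ∷ 4 ∷ []) ∷
  (0 ∷ 1 ∷ 9 ∷ 8 ∷ 12 ∷ 4 ∷ 5 ∷ 13 ∷ 15 ∷ 11 ∷ 3 ∷ 7 ∷ 6 ∷ 14 ∷ 10 ∷ 2 ∷ []) ∷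
  (0 ∷ 1 ∷ 3 ∷ 2 ∷ 10 ∷ 14 ∷ 6 ∷ 7 ∷ 5 ∷ 13 ∷ 15 ∷ 11 ∷ 9 ∷ 8 ∷ 12 ∷ 4 ∷ []) ∷ []
table 13 10 3 =
  (0 ∷ 1 ∷ 3 ∷ 11 ∷ 10 ∷ 14 ∷ 15 ∷ 13 ∷ 9 ∷ 8 ∷ 12 ∷ 4 ∷ 5 ∷ 7 ∷ 6 ∷ 2 ∷ []) ∷
  (0 ∷ 1 ∷ 5 ∷ 4 ∷ 6 ∷ 7 ∷ 15 ∷ 13 ∷ 12 ∷ 14 ∷ 10 ∷ 2 ∷ 3 ∷ 11 ∷ 9 ∷ 8 ∷ []) ∷
  (0 ∷ 1 ∷ 5 ∷ 7 ∷ 3 ∷ 11 ∷ 9 ∷ 13 ∷ 15 ∷ 14 ∷ 10 ∷ 8 ∷ 12 ∷ 4 ∷ 6 ∷ 2 ∷ []) ∷ []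
table 13 10 4 =
  (0 ∷ 1 ∷ 3 ∷ 2 ∷ 6 ∷ 7 ∷ 5 ∷ 4 ∷ 12 ∷ 13 ∷ 15 ∷ 14 ∷ 10 ∷ 11 ∷ 9 ∷ 8 ∷ []) ∷
  (0 ∷ 1 ∷ 5 ∷ 7 ∷ 3 ∷ 11 ∷ 15 ∷ 13 ∷ 9 ∷ 8 ∷ 12 ∷ 4 ∷ 6 ∷ 14 ∷ 10 ∷ 2 ∷ []) ∷
  (0 ∷ 1 ∷ 5 ∷ 4 ∷ 12 ∷ 8 ∷ 10 ∷ 14 ∷ 15 ∷ 13 ∷ 9 ∷ 11 ∷ 3 ∷ 7 ∷ 6 ∷ 2 ∷ []) ∷ []
table _ _ _ = []

fromOrigin : Vertex → Vertex → Vertex → Fin 4 → Vertex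
fromOrigin b₁ b₂ b₃ = lookup (origin ∷ b₁ ∷ b₂ ∷ b₃ ∷ [])

tableCycles : Vertex → Vertex → Vertex → List (Fin 16 → Vertex)
tableCycles b₁ b₂ b₃ = map cycleOf (table (code b₁) (code b₂) (code b₃))

table-certifies : ∀ b₁ b₂ b₃ → IsNormal (fromOrigin b₁ b₂ b₃) →
  CyclesMeetIn (canonical (fromOrigin b₁ b₂ b₃)) (tableCycles b₁ b₂ b₃)
table-certifies = toWitness {a? = allVec? λ b₁ → allVec? λ b₂ → allVec? λ b₃ →
  isNormal? (fromOrigin b₁ b₂ b₃) →-dec
  cyclesMeetIn? (canonical (fromOrigin b₁ b₂ b₃)) (tableCycles b₁ b₂ b₃)} _

HamThrough-normal-origin : ∀ {b} → IsNormal b → b zero ≡ origin → HamThrough (canonical b)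
HamThrough-normal-origin {b} normal b₀≡origin =
  HamThrough-resp (canonical-cong b'≗b) (canonical-cong (sym ∘ b'≗b))
    (CyclesMeetIn⇒HamThrough _ _
      (table-certifies (b (suc zero)) (b (suc (suc zero))) (b (suc (suc (suc zero))))
        (IsNormal-cong (sym ∘ b'≗b) normal)))
  where
  b' : Fin 4 → Vertex
  b' = fromOrigin (b (suc zero)) (b (suc (suc zero))) (b (suc (suc (suc zero))))
  b'≗b : ∀ i → b' i ≡ b i
  b'≗b zero                   = sym b₀≡origin
  b'≗b (suc zero)             = refl
  b'≗b (suc (suc zero))       = refl
  b'≗b (suc (suc (suc zero))) = refl

HamThrough-normal : ∀ {b} → IsNormal b → HamThrough (canonical b)
HamThrough-normal {b} normal =
  HamThrough-translate a (canonical b)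
    (HamThrough-resp (λ i → i , SameEdge-sym (⊕-canonical a b i)) (λ i → i , ⊕-canonical a b i)
      (HamThrough-normal-origin (IsNormal-translate a normal) (translateNormal-origin b)))
  where
  a : Vertex
  a = b zero

oneEdgePerDirection⇒normal : (M : Fin 4 → Edge) → (∀ j → IsEdge (M j)) →
  (∀ j k → j ≢ k → Disjoint (M j) (M k)) →
  (∀ i → ∃[ j ] (InDir i (M j) × (∀ k → InDir i (M k) → k ≡ j))) →
  ∃[ b ] (IsNormal b × M ⊆ᴱ canonical b × canonical b ⊆ᴱ M)
oneEdgePerDirection⇒normal M isEdge disjoint perDirection =
  b , ((λ i → lowEnd-lookup i (proj₁ (M (edgeIn i)))) , b-disjoint) ,
  M⊆b , (λ i → edgeIn i , SameEdge-sym (M-edgeIn~b i))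
  where
  edgeIn : Fin 4 → Fin 4
  edgeIn i = proj₁ (perDirection i)
  edgeIn-inDir : ∀ i → InDir i (M (edgeIn i))
  edgeIn-inDir i = proj₁ (proj₂ (perDirection i))
  b : Fin 4 → Vertex
  b i = lowEnd i (proj₁ (M (edgeIn i)))
  M-edgeIn~b : ∀ i → SameEdge (M (edgeIn i)) (canonical b i)
  M-edgeIn~b i = InDir⇒edgeAt (M (edgeIn i)) i (isEdge (edgeIn i)) (edgeIn-inDir i)
  edgeIn-injective : ∀ i i' → i ≢ i' → edgeIn i ≢ edgeIn i'
  edgeIn-injective i i' i≢i' ≡edgeIn =
    i≢i' (InDir-unique (M (edgeIn i)) (isEdge (edgeIn i)) (edgeIn-inDir i)
                       (subst (λ j → InDir i' (M j)) (sym ≡edgeIn) (edgeIn-inDir i')))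
  b-disjoint : ∀ i i' → i ≢ i' → Disjoint (canonical b i) (canonical b i')
  b-disjoint i i' i≢i' =
    Disjoint-resp (M-edgeIn~b i) (M-edgeIn~b i')
                  (disjoint (edgeIn i) (edgeIn i') (edgeIn-injective i i' i≢i'))
  M⊆b : M ⊆ᴱ canonical b
  M⊆b j with IsEdge⇒InDir (M j) (isEdge j)
  ... | i , inDir with proj₂ (proj₂ (perDirection i)) j inDir
  ...   | refl = i , M-edgeIn~b i

lemma4p4 : (f : Edge) → IsEdge f →
    (M : Fin 4 → Edge) →
    (∀ j → EdgeOfQ4-f f (M j)) →
    (∀ j k → j ≢ k → Disjoint (M j) (M k)) →
    (∀ i → ∃[ j ] (InDir i (M j) × (∀ k → InDir i (M k) → k ≡ j))) →
    ∃[ c ] (IsHamCycle f c × (∀ j → CycleContains c (M j)))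
lemma4p4 f _ M M-in-Q₄-f disjoint perDirection =
  let (b , normal , M⊆b , b⊆M) =
        oneEdgePerDirection⇒normal M (proj₁ ∘ M-in-Q₄-f) disjoint perDirection
  in  HamThrough-resp b⊆M M⊆b (HamThrough-normal normal) f (proj₂ ∘ M-in-Q₄-f)
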